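{- Let $\mathbb F$ be a field, $n,d\ge1$, $\ell\ge1$, $M=\{0,1,\dots,d\}^n$ and $M_\ell=\{\mathbf a\in M\mid\mathrm{supp}(\mathbf a)<\ell\}$. Let $T_\ell$ be the $M_\ell\times M$ matrix over $\mathbb F$ with entries $T_\ell(\mathbf a,\mathbf b)=\binom{\mathbf b}{\mathbf a}=\prod_{i=1}^n\binom{b_i}{a_i}$. Then any $2^\ell-1$ columns of $T_\ell$ are linearly independent over $\mathbb F$.
   Context: For $\mathbf a\in\mathbb N^n$, $\mathrm{supp}(\mathbf a)=|\{i:a_i\ne0\}|$. Binomial coefficients are interpreted in $\mathbb F$. -}

module Defs where

open import Level using (_⊔_)
open import Algebra.Bundles using (CommutativeRing)
open import Data.Nat using (ℕ; zero; _+_)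
open import Data.Nat.Combinatorics using (_C_)
open import Data.Fin using (Fin; zero; suc; toℕ)
import Data.Fin as Fin
import Data.Nat as ℕ
open import Data.Vec using (Vec; []; _∷_; lookup)
open import Data.Product using (Σ; _×_)
open import Relation.Nullary using (¬_)

record Field (c ℓ : Level.Level) : Set (Level.suc (c ⊔ ℓ)) where
  field
    commutativeRing : CommutativeRing c ℓ
  open CommutativeRing commutativeRing public
  field
    0≉1     : ¬ (0# ≈ 1#)
    inverse : ∀ x → ¬ (x ≈ 0#) → Σ Carrier (λ y → (x * y) ≈ 1#)

supp : ∀ {d n} → Vec (Fin (ℕ.suc d)) n → ℕ
supp []             = zero
supp (zero  ∷ as)   = supp as
supp (Fin.suc _ ∷ as) = ℕ.suc (supp as)

module _ {c ℓ} (F : Field c ℓ) where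
  open Field F
  open import Algebra.Bundles using (Semiring)
  open import Algebra.Definitions.RawSemiring (Semiring.rawSemiring semiring) using (product; sum) renaming (_×_ to _·_)

  sumF : ∀ {k} → (Fin k → Carrier) → Carrier
  sumF = sum

  fromℕ : ℕ → Carrier
  fromℕ m = m · 1#

  binomVec : ∀ {d n} → Vec (Fin (ℕ.suc d)) n → Vec (Fin (ℕ.suc d)) n → Carrier
  binomVec {n = n} a b = product (λ (i : Fin n) → fromℕ (toℕ (lookup b i) C toℕ (lookup a i)))

-- View a combination of columns as a function f on the cube {0,…,d}^n,
-- supported on a list B of fewer than 2^l points, with T_l f = 0.  Induct
-- on n and l, slicing the cube by the first coordinate w.  A row (t ∷ a) of
-- T is the sum over w of binom(w, t) times the row a of the slice f(w ∷ ·),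
-- and the matrix (binom(w, t))_{t,w} is unitriangular, so every slice is
-- killed by all rows of support < l − 1; hence every slice supported on
-- fewer than 2^(l−1) points vanishes.  At most one slice v is larger; once
-- all others vanish, the row (0 ∷ a) of T is the row a of f(v ∷ ·), so this
-- slice is killed by T_l in dimension n − 1 and vanishes by induction on n.

module Submission where

open import Defs
open import Data.Nat using (ℕ; suc; _≤_; _<_; _^_; _∸_)
open import Data.Fin using (Fin)
open import Data.Vec using (Vec)
open import Relation.Binary.PropositionalEquality using (_≡_)
open import Function.Definitions using (Injective)

open import Algebra.Bundles using (Semiring; CommutativeSemiring; CommutativeRing)
open import Data.Nat using (zero; z≤n; s≤s; _+_; _<?_)
import Data.Nat.Properties as ℕ
open import Data.Nat.Combinatorics using (_C_; nCn≡1; k>n⇒nCk≡0)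
open import Data.Fin using (toℕ; _≟_)
import Data.Fin.Properties as Fin
open import Data.Vec using ([]; _∷_; lookup)
import Data.Vec.Properties as Vec
open import Data.List using (List; []; _∷_; length; tabulate)
open import Data.List.Properties using (length-tabulate)
open import Data.List.Relation.Unary.Any using (here; there)
open import Data.List.Membership.Propositional using (_∈_; _∉_)
open import Data.List.Membership.Propositional.Properties using (∈-tabulate⁺)
open import Function using (_∘_)
open import Relation.Nullary using (¬_; yes; no; contradiction)
open import Relation.Binary.Definitions using (DecidableEquality; tri<; tri≈; tri>)
open import Relation.Binary.PropositionalEquality as ≡ using (_≢_; cong; cong₂; subst)

private
  variable
    m n k l : ℕ

Cube : ℕ → ℕ → Set
Cube m n = Vec (Fin m) n

module Fibres {a} {A : Set a} (_≟ᴬ_ : DecidableEquality A) where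

  fibre : A → List (Vec A (suc n)) → List (Vec A n)
  fibre v []            = []
  fibre v ((w ∷ b) ∷ B) with w ≟ᴬ v
  ... | yes _ = b ∷ fibre v B
  ... | no  _ = fibre v B

  ∈-fibre⁺ : ∀ {v} {b : Vec A n} {B} → (v ∷ b) ∈ B → b ∈ fibre v B
  ∈-fibre⁺ {v = v} {B = (w ∷ _) ∷ _} (here vb≡wb) with w ≟ᴬ v
  ... | yes _   = here (Vec.∷-injectiveʳ vb≡wb)
  ... | no  w≢v = contradiction (≡.sym (Vec.∷-injectiveˡ vb≡wb)) w≢v
  ∈-fibre⁺ {v = v} {B = (w ∷ _) ∷ _} (there vb∈B) with w ≟ᴬ v
  ... | yes _ = there (∈-fibre⁺ vb∈B)
  ... | no  _ = ∈-fibre⁺ vb∈B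

  length-fibre-≤ : ∀ v (B : List (Vec A (suc n))) → length (fibre v B) ≤ length B
  length-fibre-≤ v []            = z≤n
  length-fibre-≤ v ((w ∷ b) ∷ B) with w ≟ᴬ v
  ... | yes _ = s≤s (length-fibre-≤ v B)
  ... | no  _ = ℕ.m≤n⇒m≤1+n (length-fibre-≤ v B)

  length-fibres-≤ : ∀ {u v} (B : List (Vec A (suc n))) → u ≢ v →
                    length (fibre u B) + length (fibre v B) ≤ length B
  length-fibres-≤ []            u≢v = z≤n
  length-fibres-≤ {u = u} {v} ((w ∷ b) ∷ B) u≢v with w ≟ᴬ u | w ≟ᴬ v
  ... | yes w≡u | yes w≡v = contradiction (≡.trans (≡.sym w≡u) w≡v) u≢v
  ... | yes _   | no  _   = s≤s (length-fibres-≤ B u≢v)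
  ... | no  _   | yes _   =
    ℕ.≤-trans (ℕ.≤-reflexive (ℕ.+-suc _ _)) (s≤s (length-fibres-≤ B u≢v))
  ... | no  _   | no  _   = ℕ.m≤n⇒m≤1+n (length-fibres-≤ B u≢v)

  length-fibre-<-pow : ∀ l {u v} (B : List (Vec A (suc n))) → u ≢ v →
                       length B < 2 ^ suc l → ¬ length (fibre v B) < 2 ^ l →
                       length (fibre u B) < 2 ^ l
  length-fibre-<-pow l {u} {v} B u≢v |B|<2^1+l v-large =
    ℕ.+-cancelʳ-< (length (fibre v B)) _ _ (begin-strict
      length (fibre u B) + length (fibre v B) ≤⟨ length-fibres-≤ B u≢v ⟩
      length B                                <⟨ |B|<2^1+l ⟩
      2 ^ l + (2 ^ l + 0)                     ≡⟨ cong (2 ^ l +_) (ℕ.+-identityʳ (2 ^ l)) ⟩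
      2 ^ l + 2 ^ l                           ≤⟨ ℕ.+-monoʳ-≤ (2 ^ l) (ℕ.≮⇒≥ v-large) ⟩
      2 ^ l + length (fibre v B)              ∎)
    where open ℕ.≤-Reasoning

module CubeSums {c ℓ} (R : Semiring c ℓ) where

  open Semiring R
  open import Algebra.Properties.Semiring.Sum R
  open import Relation.Binary.Reasoning.Setoid setoid

  sum-zero : {f : Fin k → Carrier} → (∀ i → f i ≈ 0#) → sum f ≈ 0#
  sum-zero {k} f≈0 = trans (sum-cong-≋ f≈0) (sum-replicate-zero k)

  sum-single : ∀ (f : Fin k → Carrier) j → (∀ i → i ≢ j → f i ≈ 0#) → sum f ≈ f j
  sum-single f Fin.zero f≈0 =
    trans (+-congˡ (sum-zero (λ i → f≈0 (Fin.suc i) λ ()))) (+-identityʳ _)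
  sum-single f (Fin.suc j) f≈0 = trans (+-cong (f≈0 Fin.zero λ ()) f∘suc≈fj) (+-identityˡ _)
    where
    f∘suc≈fj : sum (f ∘ Fin.suc) ≈ f (Fin.suc j)
    f∘suc≈fj = sum-single (f ∘ Fin.suc) j (λ i i≢j → f≈0 (Fin.suc i) (i≢j ∘ Fin.suc-injective))

  slice : (Cube m (suc n) → Carrier) → Fin m → Cube m n → Carrier
  slice f w b = f (w ∷ b)

  cubeSum : (Cube m n → Carrier) → Carrier
  cubeSum {n = zero}  f = f []
  cubeSum {n = suc n} f = sum (λ v → cubeSum (slice f v))

  cubeSum-cong : {f g : Cube m n → Carrier} → (∀ b → f b ≈ g b) → cubeSum f ≈ cubeSum g
  cubeSum-cong {n = zero}  f≈g = f≈g []
  cubeSum-cong {n = suc n} {f} {g} f≈g =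
    sum-cong-≋ (λ v → cubeSum-cong {f = slice f v} {slice g v} (f≈g ∘ (v ∷_)))

  cubeSum-zero : {f : Cube m n → Carrier} → (∀ b → f b ≈ 0#) → cubeSum f ≈ 0#
  cubeSum-zero {n = zero}  f≈0 = f≈0 []
  cubeSum-zero {n = suc n} {f} f≈0 = sum-zero (λ v → cubeSum-zero {f = slice f v} (f≈0 ∘ (v ∷_)))

  *-distribˡ-cubeSum : ∀ x (f : Cube m n → Carrier) → x * cubeSum f ≈ cubeSum (λ b → x * f b)
  *-distribˡ-cubeSum {n = zero}  x f = refl
  *-distribˡ-cubeSum {n = suc n} x f =
    trans (*-distribˡ-sum x (cubeSum ∘ slice f)) (sum-cong-≋ (*-distribˡ-cubeSum x ∘ slice f))

  cubeSum-comm-sum : (f : Cube m n → Fin k → Carrier) →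
                     cubeSum (λ b → sum (f b)) ≈ sum (λ j → cubeSum (λ b → f b j))
  cubeSum-comm-sum {n = zero}  f = refl
  cubeSum-comm-sum {n = suc n} f =
    trans (sum-cong-≋ (λ v → cubeSum-comm-sum (f ∘ (v ∷_))))
          (∑-comm (λ v j → cubeSum (λ b → f (v ∷ b) j)))

  δ : Cube m n → Cube m n → Carrier
  δ []       []       = 1#
  δ (x ∷ xs) (y ∷ ys) with x ≟ y
  ... | yes _ = δ xs ys
  ... | no  _ = 0#

  δ-refl : (x : Cube m n) → δ x x ≈ 1#
  δ-refl []       = refl
  δ-refl (x ∷ xs) with x ≟ x
  ... | yes _   = δ-refl xs
  ... | no  x≢x = contradiction ≡.refl x≢x

  δ-≢ : {x y : Cube m n} → x ≢ y → δ x y ≈ 0#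
  δ-≢ {x = []}     {[]}     x≢y = contradiction ≡.refl x≢y
  δ-≢ {x = x ∷ xs} {y ∷ ys} x≢y with x ≟ y
  ... | yes x≡y = δ-≢ (x≢y ∘ cong₂ _∷_ x≡y)
  ... | no  _   = refl

  δ-∷ : ∀ x (xs ys : Cube m n) → δ (x ∷ xs) (x ∷ ys) ≈ δ xs ys
  δ-∷ x xs ys with x ≟ x
  ... | yes _   = refl
  ... | no  x≢x = contradiction ≡.refl x≢x

  cubeSum-δ : ∀ (x : Cube m n) f → cubeSum (λ b → δ x b * f b) ≈ f x
  cubeSum-δ []       f = *-identityˡ (f [])
  cubeSum-δ (x ∷ xs) f = begin
    sum (λ v → cubeSum (λ b → δ (x ∷ xs) (v ∷ b) * f (v ∷ b)))
      ≈⟨ sum-single _ x off-diagonal ⟩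
    cubeSum (λ b → δ (x ∷ xs) (x ∷ b) * f (x ∷ b))
      ≈⟨ cubeSum-cong (*-congʳ ∘ δ-∷ x xs) ⟩
    cubeSum (λ b → δ xs b * f (x ∷ b))
      ≈⟨ cubeSum-δ xs (slice f x) ⟩
    f (x ∷ xs)
      ∎
    where
    off-diagonal : ∀ v → v ≢ x → cubeSum (λ b → δ (x ∷ xs) (v ∷ b) * f (v ∷ b)) ≈ 0#
    off-diagonal v v≢x = cubeSum-zero {f = λ b → δ (x ∷ xs) (v ∷ b) * f (v ∷ b)} (λ b →
      trans (*-congʳ (δ-≢ (v≢x ∘ ≡.sym ∘ Vec.∷-injectiveˡ))) (zeroˡ _))

  combination : (Fin k → Cube m n) → (Fin k → Carrier) → Cube m n → Carrier
  combination cols coef b = sum (λ j → coef j * δ (cols j) b)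

  cubeSum-combination : ∀ (cols : Fin k → Cube m n) coef f →
    cubeSum (λ b → combination cols coef b * f b) ≈ sum (λ j → coef j * f (cols j))
  cubeSum-combination cols coef f = begin
    cubeSum (λ b → sum (λ j → coef j * δ (cols j) b) * f b)
      ≈⟨ cubeSum-cong (λ b → *-distribʳ-sum (f b) (λ j → coef j * δ (cols j) b)) ⟩
    cubeSum (λ b → sum (λ j → coef j * δ (cols j) b * f b))
      ≈⟨ cubeSum-comm-sum (λ b j → coef j * δ (cols j) b * f b) ⟩
    sum (λ j → cubeSum (λ b → coef j * δ (cols j) b * f b))
      ≈⟨ sum-cong-≋ (λ j → cubeSum-cong (λ b → *-assoc (coef j) (δ (cols j) b) (f b))) ⟩
    sum (λ j → cubeSum (λ b → coef j * (δ (cols j) b * f b)))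
      ≈⟨ sum-cong-≋ (λ j → *-distribˡ-cubeSum (coef j) (λ b → δ (cols j) b * f b)) ⟨
    sum (λ j → coef j * cubeSum (λ b → δ (cols j) b * f b))
      ≈⟨ sum-cong-≋ (λ j → *-congˡ (cubeSum-δ (cols j) f)) ⟩
    sum (λ j → coef j * f (cols j))
      ∎

  combination-at : {cols : Fin k → Cube m n} → Injective _≡_ _≡_ cols →
                   ∀ coef j → combination cols coef (cols j) ≈ coef j
  combination-at {cols = cols} cols-injective coef j = begin
    sum (λ i → coef i * δ (cols i) (cols j)) ≈⟨ sum-single _ j off-diagonal ⟩
    coef j * δ (cols j) (cols j)             ≈⟨ *-congˡ (δ-refl (cols j)) ⟩
    coef j * 1#                              ≈⟨ *-identityʳ (coef j) ⟩
    coef j                                   ∎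
    where
    off-diagonal : ∀ i → i ≢ j → coef i * δ (cols i) (cols j) ≈ 0#
    off-diagonal i i≢j = trans (*-congˡ (δ-≢ (i≢j ∘ cols-injective))) (zeroʳ _)

  combination-∉ : ∀ (cols : Fin k → Cube m n) coef {b} → b ∉ tabulate cols →
                  combination cols coef b ≈ 0#
  combination-∉ cols coef b∉cols = sum-zero (λ j → trans (*-congˡ (δ-≢ (cols-j≢b j))) (zeroʳ _))
    where
    cols-j≢b : ∀ j → cols j ≢ _
    cols-j≢b j cols-j≡b = b∉cols (subst (_∈ tabulate cols) cols-j≡b (∈-tabulate⁺ j))

module Binomials {c ℓ} (R : CommutativeSemiring c ℓ) where

  open CommutativeSemiring R hiding (_+_)
  open import Algebra.Properties.Semiring.Sum semiring
  open import Algebra.Definitions.RawSemiring rawSemiring using (product) renaming (_×_ to _·_)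
  open import Algebra.Properties.CommutativeSemigroup *-commutativeSemigroup using (x∙yz≈y∙xz)
  open CubeSums semiring
  open import Relation.Binary.Reasoning.Setoid setoid

  binomial : ℕ → ℕ → Carrier
  binomial n k = (n C k) · 1#

  binomial-diagonal : ∀ n → binomial n n ≈ 1#
  binomial-diagonal n rewrite nCn≡1 n = +-identityʳ 1#

  binomial-0 : ∀ n → binomial n 0 ≈ 1#
  binomial-0 n = +-identityʳ 1#

  binomial-above : n < k → binomial n k ≈ 0#
  binomial-above n<k rewrite k>n⇒nCk≡0 n<k = refl

  binomialTransform : (Fin m → Carrier) → Fin m → Carrier
  binomialTransform g t = sum (λ v → binomial (toℕ v) (toℕ t) * g v)

  binomialTransform-zero⇒zero : ∀ (g : Fin m → Carrier) →
                                (∀ t → binomialTransform g t ≈ 0#) → ∀ v → g v ≈ 0#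
  binomialTransform-zero⇒zero {m} g Tg≈0 v = vanishes m v (ℕ.m≤m+n m (toℕ v))
    where
    vanishes : ∀ i w → m ≤ i + toℕ w → g w ≈ 0#
    vanishes zero    w m≤w = contradiction m≤w (ℕ.<⇒≱ (Fin.toℕ<n w))
    vanishes (suc i) w m≤1+i+w = begin
      g w
        ≈⟨ trans (*-congʳ (binomial-diagonal (toℕ w))) (*-identityˡ (g w)) ⟨
      binomial (toℕ w) (toℕ w) * g w
        ≈⟨ sum-single _ w off-diagonal ⟨
      binomialTransform g w
        ≈⟨ Tg≈0 w ⟩
      0#
        ∎
      where
      off-diagonal : ∀ u → u ≢ w → binomial (toℕ u) (toℕ w) * g u ≈ 0#
      off-diagonal u u≢w with ℕ.<-cmp (toℕ u) (toℕ w)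
      ... | tri< u<w _ _ = trans (*-congʳ (binomial-above u<w)) (zeroˡ (g u))
      ... | tri≈ _ u≡w _ = contradiction (Fin.toℕ-injective u≡w) u≢w
      ... | tri> _ _ u>w = trans (*-congˡ (vanishes i u m≤i+u)) (zeroʳ _)
        where
        m≤i+u : m ≤ i + toℕ u
        m≤i+u = ℕ.≤-trans m≤1+i+w
          (ℕ.≤-trans (ℕ.≤-reflexive (≡.sym (ℕ.+-suc i (toℕ w)))) (ℕ.+-monoʳ-≤ i u>w))

  binomialProduct : Cube m n → Cube m n → Carrier
  binomialProduct {n = n} a b =
    product (λ (i : Fin n) → binomial (toℕ (lookup b i)) (toℕ (lookup a i)))

  T : (Cube m n → Carrier) → Cube m n → Carrier
  T f a = cubeSum (λ b → f b * binomialProduct a b)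

  T-∷ : ∀ (f : Cube m (suc n) → Carrier) t a →
        T f (t ∷ a) ≈ binomialTransform (λ w → T (slice f w) a) t
  T-∷ f t a = sum-cong-≋ (λ v → sym (trans
    (*-distribˡ-cubeSum (binomial (toℕ v) (toℕ t)) (λ b → f (v ∷ b) * binomialProduct a b))
    (cubeSum-cong (λ b → x∙yz≈y∙xz _ (f (v ∷ b)) (binomialProduct a b)))))

module Kernel {c ℓ} (R : CommutativeSemiring c ℓ) (d : ℕ) where

  open CommutativeSemiring R
  open CubeSums semiring
  open Binomials R
  open Fibres {A = Fin (suc d)} _≟_
  open import Relation.Binary.Reasoning.Setoid setoid

  InKernel : ℕ → (Cube (suc d) n → Carrier) → Set ℓ
  InKernel l f = ∀ a → supp a < l → T f a ≈ 0#

  supp-∷-< : ∀ t (a : Cube (suc d) n) → supp a < l → supp (t ∷ a) < suc l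
  supp-∷-< Fin.zero    a supp<l = ℕ.m<n⇒m<1+n supp<l
  supp-∷-< (Fin.suc _) a supp<l = s≤s supp<l

  slice-inKernel : {f : Cube (suc d) (suc n) → Carrier} →
                   InKernel (suc l) f → ∀ w → InKernel l (slice f w)
  slice-inKernel {f = f} f∈ker w a supp<l = binomialTransform-zero⇒zero (λ w → T (slice f w) a)
    (λ t → trans (sym (T-∷ f t a)) (f∈ker (t ∷ a) (supp-∷-< t a supp<l))) w

  slice-inKernel-if-others-vanish : {f : Cube (suc d) (suc n) → Carrier} → InKernel (suc l) f →
    ∀ v → (∀ w → w ≢ v → ∀ b → slice f w b ≈ 0#) → InKernel (suc l) (slice f v)
  slice-inKernel-if-others-vanish {f = f} f∈ker v others≈0 a supp<1+l = begin
    T (slice f v) a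
      ≈⟨ trans (*-congʳ (binomial-0 (toℕ v))) (*-identityˡ _) ⟨
    binomial (toℕ v) 0 * T (slice f v) a
      ≈⟨ sum-single _ v off-slice ⟨
    binomialTransform (λ w → T (slice f w) a) Fin.zero
      ≈⟨ T-∷ f Fin.zero a ⟨
    T f (Fin.zero ∷ a)
      ≈⟨ f∈ker (Fin.zero ∷ a) supp<1+l ⟩
    0#
      ∎
    where
    off-slice : ∀ w → w ≢ v → binomial (toℕ w) 0 * T (slice f w) a ≈ 0#
    off-slice w w≢v =
      trans (*-congˡ (cubeSum-zero (λ b → trans (*-congʳ (others≈0 w w≢v b)) (zeroˡ _)))) (zeroʳ _)

  inKernel-supported⇒zero : ∀ n l (f : Cube (suc d) n → Carrier) (B : List (Cube (suc d) n)) →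
                            length B < 2 ^ l → (∀ b → b ∉ B → f b ≈ 0#) → InKernel l f →
                            ∀ b → f b ≈ 0#
  inKernel-supported⇒zero n       zero    f []      _        f⊆B _ b = f⊆B b λ ()
  inKernel-supported⇒zero n       zero    f (_ ∷ _) (s≤s ()) _   _
  inKernel-supported⇒zero zero    (suc l) f B       _        _   f∈ker [] =
    trans (sym (*-identityʳ _)) (f∈ker [] (s≤s z≤n))
  inKernel-supported⇒zero (suc n) (suc l) f B |B|<2^1+l f⊆B f∈ker (v ∷ b) = slice-vanishes v b
    where
    slice-supported : ∀ w b → b ∉ fibre w B → slice f w b ≈ 0#
    slice-supported w b b∉ = f⊆B (w ∷ b) (b∉ ∘ ∈-fibre⁺)

    small-slice-vanishes : ∀ w → length (fibre w B) < 2 ^ l → ∀ b → slice f w b ≈ 0#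
    small-slice-vanishes w small = inKernel-supported⇒zero n l (slice f w) (fibre w B) small
      (slice-supported w) (slice-inKernel {f = f} f∈ker w)

    slice-vanishes : ∀ w b → slice f w b ≈ 0#
    slice-vanishes w with length (fibre w B) <? 2 ^ l
    ... | yes small = small-slice-vanishes w small
    ... | no  large = inKernel-supported⇒zero n (suc l) (slice f w) (fibre w B)
      (ℕ.≤-<-trans (length-fibre-≤ w B) |B|<2^1+l) (slice-supported w)
      (slice-inKernel-if-others-vanish {f = f} f∈ker w others-vanish)
      where
      others-vanish : ∀ u → u ≢ w → ∀ b → slice f u b ≈ 0#
      others-vanish u u≢w = small-slice-vanishes u (length-fibre-<-pow l B u≢w |B|<2^1+l large)

lemma5p3 : ∀ {c ℓ'} (F : Field c ℓ') (n d l : ℕ) → 1 ≤ n → 1 ≤ d → 1 ≤ l →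
    (k : ℕ) → k ≤ 2 ^ l ∸ 1 →
    (cols : Fin k → Vec (Fin (suc d)) n) → Injective _≡_ _≡_ cols →
    (coef : Fin k → Field.Carrier F) →
    (∀ (a : Vec (Fin (suc d)) n) → supp a < l →
    Field._≈_ F (sumF F (λ j → Field._*_ F (coef j) (binomVec F a (cols j)))) (Field.0# F)) →
    ∀ j → Field._≈_ F (coef j) (Field.0# F)
lemma5p3 F n d l _ _ _ k k≤2^l∸1 cols cols-injective coef T·coef≈0 j = begin
  coef j                         ≈⟨ combination-at cols-injective coef j ⟨
  combination cols coef (cols j) ≈⟨ inKernel-supported⇒zero n l (combination cols coef) (tabulate cols)
                                      |cols|<2^l (λ _ → combination-∉ cols coef) combination∈ker (cols j) ⟩
  0#                             ∎
  where
  R : CommutativeSemiring _ _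
  R = CommutativeRing.commutativeSemiring (Field.commutativeRing F)
  open CommutativeSemiring R
  open CubeSums semiring
  open Binomials R using (binomialProduct)
  open Kernel R d
  open import Relation.Binary.Reasoning.Setoid setoid

  |cols|<2^l : length (tabulate cols) < 2 ^ l
  |cols|<2^l rewrite length-tabulate cols =
    ℕ.≤-trans (s≤s k≤2^l∸1) (ℕ.≤-reflexive (ℕ.m+[n∸m]≡n (ℕ.m^n>0 2 l)))

  combination∈ker : InKernel l (combination cols coef)
  combination∈ker a supp<l =
    trans (cubeSum-combination cols coef (binomialProduct a)) (T·coef≈0 a supp<l)
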